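{- For $n \ge 2$ let $A$ be the $n\times n$ matrix with entries $A_{ij} = (n+1-i) + j$ (an $n\times n$ $TP_2$ matrix). There is an absolute constant $c > 0$ such that for all sufficiently large $n$ there exists a real $\alpha$ for which the number of $2\times 2$ minors of $A$ (choices of a pair of rows and a pair of columns) equal to $\alpha$ is at least $n^{2 + \frac{c}{\log\log n}}$.
   Context: A real matrix is $TP_2$ if all its $1\times 1$ and $2\times 2$ minors are positive. -}

module Defs where

open import Data.Nat using (ℕ; suc; _+_; _∸_; _<_; _<?_)
open import Data.Nat.Logarithm using (⌊log₂_⌋)
open import Data.Integer as ℤ using (ℤ; +_)
open import Data.Fin using (Fin; toℕ)
open import Data.List using (List; []; _∷_; length; filter; concatMap; allFin)
open import Data.Product using (_×_; _,_)
open import Relation.Nullary using (Dec; yes; no)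
open import Relation.Nullary.Decidable using (_×-dec_)

-- The n×n matrix A with (1-based) entries A_ij = (n+1-i) + j.
-- With 0-based Fin indices i = toℕ i' + 1, this is n - toℕ i' + toℕ j' + 1.
A : (n : ℕ) → Fin n → Fin n → ℤ
A n i j = + ((n ∸ toℕ i) + suc (toℕ j))

Quad : ℕ → Set
Quad n = (Fin n × Fin n) × (Fin n × Fin n)

pairs : (n : ℕ) → List (Fin n × Fin n)
pairs n = filter (λ p → toℕ (Data.Product.proj₁ p) <? toℕ (Data.Product.proj₂ p))
            (concatMap (λ i → Data.List.map (λ i' → (i , i')) (allFin n)) (allFin n))

quads : (n : ℕ) → List (Quad n)
quads n = concatMap (λ r → Data.List.map (λ c → (r , c)) (pairs n)) (pairs n)

minor : (n : ℕ) → Quad n → ℤ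
minor n ((i , i') , (j , j')) =
  (A n i j ℤ.* A n i' j') ℤ.- (A n i j' ℤ.* A n i' j)

countMinors : (n : ℕ) → ℤ → ℕ
countMinors n α = length (filter (λ q → minor n q ℤ.≟ α) (quads n))

-- ⌊log₂ ⌊log₂ n⌋⌋ : integer surrogate for log log n
loglog : ℕ → ℕ
loglog n = ⌊log₂ ⌊log₂ n ⌋ ⌋

module Submission where

-- The entry A_ij = (n+1-i) + j is a row term plus a column term, so the
-- minor on rows i < i' and columns j < j' equals (i' - i)(j' - j), and the minors equal to
-- α are counted by the pairs (row pair, column pair) whose gaps multiply to α.  A gap
-- d ∈ [1, h] is realised by at least n - h index pairs, so every factorisation α = d e with
-- d, e ≤ h contributes at least (n - h)^2 minors equal to α.  We take α to be a product of
-- s distinct primes, whose 2^s divisors give 2^s such factorisations.  Enough small primes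
-- exist by a Chebyshev-type bound: k+1, ..., 2k+1 all divide Π_{p ≤ 2k+1} p^t when
-- 2k+1 < 2^(t+1), and any common multiple of them is at least 2^k, which forces at least
-- k / (t(t+1)) primes up to 2k+1.  With t = ⌊log₂ n⌋ = v + 1, L = ⌊log₂ t⌋, primes below
-- 2^(2L+4), s = ⌊v / (2L+4)⌋ and h = 2^v we get 2^(2v+s) ≥ n^(2 + 1/(8L)) minors equal to α.

open import Defs
open import Data.Nat using (ℕ; _≤_; _*_; _+_; _^_)
open import Data.Integer using (ℤ)
open import Data.Product using (Σ; _×_; _,_; proj₁; proj₂)

open import Data.Nat
  using ( zero; suc; pred; _∸_; _<_; _<?_; _≤?_; z≤n; s≤s; NonZero; >-nonZero; >-nonZero⁻¹
        ; nonTrivial⇒n>1; _!; ⌊_/2⌋; ⌈_/2⌉ )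
open import Data.Nat.Properties
open import Data.Nat.Logarithm using (⌊log₂_⌋; ⌊log₂⌋-mono-≤; ⌊log₂⌊n/2⌋⌋≡⌊log₂n⌋∸1; ⌊log₂[2^n]⌋≡n)
open import Data.Nat.DivMod using (_/_; _%_; m≡m%n+[m/n]*n; m%n<n; m*n/n≡m; /-monoˡ-≤; m/n*n≤m)
open import Data.Nat.Divisibility
  using ( _∣_; _∣?_; divides; ∣⇒≤; 0∣⇒≡0; ∣-refl; ∣-trans; _∣0; m∣m*n; ∣n⇒∣m*n
        ; *-monoʳ-∣; *-monoˡ-∣; *-pres-∣; ∣m+n∣m⇒∣n )
open import Data.Nat.Primality
  using (Prime; prime?; prime⇒nonZero; prime⇒nonTrivial; productOfPrimes≥1)
open import Data.Nat.Primality.Factorisation using (factorise; factorisationHasAllPrimeFactors)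
open import Data.Nat.ListAction using (product)
open import Data.Nat.ListAction.Properties using (product≢0)
open import Data.Nat.Induction using (<-wellFounded)
open import Data.Nat.Tactic.RingSolver using (solve-∀)
import Data.Integer as ℤ
import Data.Integer.Properties as ℤ
import Data.Integer.Tactic.RingSolver as ℤSolver
open import Data.Fin as Fin using (Fin; toℕ)
open import Data.Fin.Properties using (toℕ<n)
open import Data.List
  using (List; []; _∷_; length; _++_; map; concatMap; filter; tabulate; allFin; applyUpTo; upTo; take)
open import Data.List.Properties using (length-++; length-map; length-take)
open import Data.List.Membership.Propositional using (_∈_)
open import Data.List.Membership.Propositional.Properties
  using (∈-∃++; ∈-++⁻; ∈-++⁺ˡ; ∈-++⁺ʳ; ∈-map⁻; ∈-applyUpTo⁺; ∈-upTo⁺; ∈-upTo⁻; ∈-filter⁺)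
open import Data.List.Relation.Unary.Any using (here; there)
open import Data.List.Relation.Unary.All as All using (All; []; _∷_)
import Data.List.Relation.Unary.All.Properties as AllP
open import Data.List.Relation.Unary.AllPairs using ([]; _∷_)
open import Data.List.Relation.Unary.Unique.Propositional using (Unique)
import Data.List.Relation.Unary.Unique.Propositional.Properties as Unique
open import Data.Sum using (inj₁; inj₂)
open import Data.Bool using (true; false; if_then_else_)
open import Function using (_∘_)
open import Induction.WellFounded using (Acc; acc)
open import Relation.Nullary using (Dec; does; yes; no; ¬_; contradiction)
open import Relation.Nullary.Decidable using (dec-true)
open import Relation.Unary using (Pred; Decidable)
open import Relation.Binary.PropositionalEquality
  using (_≡_; _≢_; refl; sym; trans; cong; cong₂; subst; subst₂; module ≡-Reasoning)

private
  variable
    X Y : Set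

𝟙 : ∀ {p} {P : Set p} → Dec P → ℕ
𝟙 d = if does d then 1 else 0

𝟙-true : ∀ {p} {P : Set p} (d : Dec P) → P → 𝟙 d ≡ 1
𝟙-true d x = cong (if_then 1 else 0) (dec-true d x)

sumOver : (X → ℕ) → List X → ℕ
sumOver w []       = 0
sumOver w (x ∷ xs) = w x + sumOver w xs

sumBelow : (ℕ → ℕ) → ℕ → ℕ
sumBelow f zero    = 0
sumBelow f (suc n) = f 0 + sumBelow (f ∘ suc) n

sumOver-++ : ∀ (w : X → ℕ) xs ys → sumOver w (xs ++ ys) ≡ sumOver w xs + sumOver w ys
sumOver-++ w []       ys = refl
sumOver-++ w (x ∷ xs) ys = trans (cong (w x +_) (sumOver-++ w xs ys)) (sym (+-assoc (w x) _ _))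

sumOver-cong : ∀ {w v : X → ℕ} xs → All (λ x → w x ≡ v x) xs → sumOver w xs ≡ sumOver v xs
sumOver-cong []       []       = refl
sumOver-cong (x ∷ xs) (e ∷ es) = cong₂ _+_ e (sumOver-cong xs es)

sumOver-map : ∀ (w : Y → ℕ) (f : X → Y) xs → sumOver w (map f xs) ≡ sumOver (w ∘ f) xs
sumOver-map w f []       = refl
sumOver-map w f (x ∷ xs) = cong (w (f x) +_) (sumOver-map w f xs)

sumOver-concatMap : ∀ (w : Y → ℕ) (f : X → List Y) xs →
                    sumOver w (concatMap f xs) ≡ sumOver (sumOver w ∘ f) xs
sumOver-concatMap w f []       = refl
sumOver-concatMap w f (x ∷ xs) =
  trans (sumOver-++ w (f x) (concatMap f xs)) (cong (sumOver w (f x) +_) (sumOver-concatMap w f xs))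

sumOver-filter : ∀ {p} {P : Pred X p} (P? : Decidable P) (w : X → ℕ) xs →
                 sumOver w (filter P? xs) ≡ sumOver (λ x → 𝟙 (P? x) * w x) xs
sumOver-filter P? w []       = refl
sumOver-filter P? w (x ∷ xs) with does (P? x)
... | true  = cong₂ _+_ (sym (+-identityʳ (w x))) (sumOver-filter P? w xs)
... | false = sumOver-filter P? w xs

length-filter : ∀ {p} {P : Pred X p} (P? : Decidable P) xs →
                length (filter P? xs) ≡ sumOver (𝟙 ∘ P?) xs
length-filter P? []       = refl
length-filter P? (x ∷ xs) with does (P? x)
... | true  = cong suc (length-filter P? xs)
... | false = length-filter P? xs

length≤sumOver : ∀ (w : X → ℕ) xs → All (λ x → 1 ≤ w x) xs → length xs ≤ sumOver w xs
length≤sumOver w []       []       = z≤n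
length≤sumOver w (x ∷ xs) (p ∷ ps) = +-mono-≤ p (length≤sumOver w xs ps)

sumOver-⊆ : ∀ (w : X → ℕ) ys xs → Unique ys → All (_∈ xs) ys → sumOver w ys ≤ sumOver w xs
sumOver-⊆ w []       xs _          _            = z≤n
sumOver-⊆ w (y ∷ ys) xs (y∉ys ∷ u) (y∈xs ∷ ys⊆) with as , bs , refl ← ∈-∃++ y∈xs = begin
  w y + sumOver w ys               ≤⟨ +-monoʳ-≤ (w y) (sumOver-⊆ w ys (as ++ bs) u ys⊆as++bs) ⟩
  w y + sumOver w (as ++ bs)       ≡⟨ cong (w y +_) (sumOver-++ w as bs) ⟩
  w y + (sumOver w as + sumOver w bs) ≡⟨ +-comm (w y) _ ⟩
  (sumOver w as + sumOver w bs) + w y ≡⟨ +-assoc (sumOver w as) _ _ ⟩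
  sumOver w as + (sumOver w bs + w y) ≡⟨ cong (sumOver w as +_) (+-comm _ (w y)) ⟩
  sumOver w as + sumOver w (y ∷ bs) ≡⟨ sym (sumOver-++ w as (y ∷ bs)) ⟩
  sumOver w (as ++ y ∷ bs)         ∎
  where
  open ≤-Reasoning
  dropY : ∀ {z} → y ≢ z × z ∈ as ++ y ∷ bs → z ∈ as ++ bs
  dropY (y≢z , z∈) with ∈-++⁻ as z∈
  ... | inj₁ z∈as         = ∈-++⁺ˡ z∈as
  ... | inj₂ (here refl)  = contradiction refl y≢z
  ... | inj₂ (there z∈bs) = ∈-++⁺ʳ as z∈bs
  -- the other elements of ys differ from y, so they survive its removal from xs
  ys⊆as++bs : All (_∈ as ++ bs) ys
  ys⊆as++bs = All.zipWith dropY (y∉ys , ys⊆)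

sumOver-tabulate : ∀ n (F : Fin n → X) (w : X → ℕ) (f : ℕ → ℕ) → (∀ x → w (F x) ≡ f (toℕ x)) →
                   sumOver w (tabulate F) ≡ sumBelow f n
sumOver-tabulate zero    F w f e = refl
sumOver-tabulate (suc n) F w f e =
  cong₂ _+_ (e Fin.zero) (sumOver-tabulate n (F ∘ Fin.suc) w (f ∘ suc) (e ∘ Fin.suc))

sumOver-applyUpTo : ∀ (w : ℕ → ℕ) f n → sumOver w (applyUpTo f n) ≡ sumBelow (w ∘ f) n
sumOver-applyUpTo w f zero    = refl
sumOver-applyUpTo w f (suc n) = cong (w (f 0) +_) (sumOver-applyUpTo w (f ∘ suc) n)

sumBelow-cong : ∀ {f g} n → (∀ x → f x ≡ g x) → sumBelow f n ≡ sumBelow g n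
sumBelow-cong zero    e = refl
sumBelow-cong (suc n) e = cong₂ _+_ (e 0) (sumBelow-cong n (e ∘ suc))

sumBelow-mono : ∀ {f g} n → (∀ x → x < n → f x ≤ g x) → sumBelow f n ≤ sumBelow g n
sumBelow-mono zero    le = z≤n
sumBelow-mono (suc n) le = +-mono-≤ (le 0 (s≤s z≤n)) (sumBelow-mono n (λ x x<n → le (suc x) (s≤s x<n)))

sumBelow-prefix : ∀ f {k n} → k ≤ n → sumBelow f k ≤ sumBelow f n
sumBelow-prefix f {zero}  _         = z≤n
sumBelow-prefix f {suc k} (s≤s k≤n) = +-monoʳ-≤ (f 0) (sumBelow-prefix (f ∘ suc) k≤n)

sumBelow-lower : ∀ f c n → (∀ x → x < n → c ≤ f x) → n * c ≤ sumBelow f n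
sumBelow-lower f c n le = subst (_≤ sumBelow f n) (sumBelow-constant n) (sumBelow-mono n le)
  where
  sumBelow-constant : ∀ n → sumBelow (λ _ → c) n ≡ n * c
  sumBelow-constant zero    = refl
  sumBelow-constant (suc n) = cong (c +_) (sumBelow-constant n)

sumBelow-split : ∀ f a b → sumBelow f (a + b) ≡ sumBelow f a + sumBelow (λ x → f (a + x)) b
sumBelow-split f zero    b = refl
sumBelow-split f (suc a) b = trans (cong (f 0 +_) (sumBelow-split (f ∘ suc) a b)) (sym (+-assoc (f 0) _ _))

term≤sumBelow : ∀ f {x n} → x < n → f x ≤ sumBelow f n
term≤sumBelow f {zero}  {suc n} _         = m≤m+n (f 0) _
term≤sumBelow f {suc x} {suc n} (s≤s x<n) = ≤-trans (term≤sumBelow (f ∘ suc) x<n) (m≤n+m _ (f 0))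

sumBelow-scale : ∀ f c n → sumBelow (λ x → c * f x) n ≡ c * sumBelow f n
sumBelow-scale f c zero    = sym (*-zeroʳ c)
sumBelow-scale f c (suc n) =
  trans (cong (c * f 0 +_) (sumBelow-scale (f ∘ suc) c n)) (sym (*-distribˡ-+ c (f 0) _))

gap : ∀ {n} → Fin n × Fin n → ℕ
gap (i , i') = toℕ i' ∸ toℕ i

pairs-increasing : ∀ n → All (λ r → toℕ (proj₁ r) < toℕ (proj₂ r)) (pairs n)
pairs-increasing n =
  AllP.all-filter (λ r → toℕ (proj₁ r) <? toℕ (proj₂ r)) (concatMap (λ i → map (i ,_) (allFin n)) (allFin n))

-- A matrix whose entries are (row term) + (column term) has 2×2 minors equal to a
-- product of differences; here the row terms are u+du, u and the column terms b, b+db.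
additive-minor : ∀ (u du b db : ℤ) →
  (u ℤ.+ du ℤ.+ b) ℤ.* (u ℤ.+ (b ℤ.+ db)) ℤ.- (u ℤ.+ du ℤ.+ (b ℤ.+ db)) ℤ.* (u ℤ.+ b) ≡ du ℤ.* db
additive-minor = ℤSolver.solve-∀

minor≡gap*gap : ∀ n (i i' j j' : Fin n) → toℕ i < toℕ i' → toℕ j < toℕ j' →
                minor n ((i , i') , (j , j')) ≡ ℤ.+ (gap (i , i') * gap (j , j'))
minor≡gap*gap n i i' j j' i<i' j<j' = begin
  minor n ((i , i') , (j , j'))
    ≡⟨ cong₂ ℤ._-_ (cong₂ ℤ._*_ Aij Ai'j') (cong₂ ℤ._*_ Aij' Ai'j) ⟩
  (U ℤ.+ DU ℤ.+ B) ℤ.* (U ℤ.+ (B ℤ.+ DB)) ℤ.- (U ℤ.+ DU ℤ.+ (B ℤ.+ DB)) ℤ.* (U ℤ.+ B)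
    ≡⟨ additive-minor U DU B DB ⟩
  DU ℤ.* DB
    ≡⟨ sym (ℤ.pos-* du db) ⟩
  ℤ.+ (du * db) ∎
  where
  open ≡-Reasoning
  u  = n ∸ toℕ i'
  du = gap (i , i')
  b  = suc (toℕ j)
  db = gap (j , j')
  U  = ℤ.+ u
  DU = ℤ.+ du
  B  = ℤ.+ b
  DB = ℤ.+ db
  row : n ∸ toℕ i ≡ u + du
  row = begin
    n ∸ toℕ i            ≡⟨ cong (_∸ toℕ i) (sym (m∸n+n≡m (<⇒≤ (toℕ<n i')))) ⟩
    (u + toℕ i') ∸ toℕ i ≡⟨ +-∸-assoc u (<⇒≤ i<i') ⟩
    u + du               ∎
  column : suc (toℕ j') ≡ b + db
  column = cong suc (sym (m+[n∸m]≡n (<⇒≤ j<j')))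
  Aij : A n i j ≡ U ℤ.+ DU ℤ.+ B
  Aij = trans (cong (λ z → ℤ.+ (z + b)) row)
              (trans (ℤ.pos-+ (u + du) b) (cong (ℤ._+ B) (ℤ.pos-+ u du)))
  Ai'j' : A n i' j' ≡ U ℤ.+ (B ℤ.+ DB)
  Ai'j' = trans (cong (λ z → ℤ.+ (u + z)) column)
                (trans (ℤ.pos-+ u (b + db)) (cong (ℤ._+_ U) (ℤ.pos-+ b db)))
  Aij' : A n i j' ≡ U ℤ.+ DU ℤ.+ (B ℤ.+ DB)
  Aij' = trans (cong₂ (λ z w → ℤ.+ (z + w)) row column)
               (trans (ℤ.pos-+ (u + du) (b + db)) (cong₂ ℤ._+_ (ℤ.pos-+ u du) (ℤ.pos-+ b db)))
  Ai'j : A n i' j ≡ U ℤ.+ B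
  Ai'j = ℤ.pos-+ u b

pairSum : ℕ → (ℕ → ℕ) → ℕ
pairSum n g = sumOver (g ∘ gap) (pairs n)

productIs : ℕ → ℕ → ℕ → ℕ
productIs α d e = 𝟙 (ℤ.+ (d * e) ℤ.≟ ℤ.+ α)

countMinors≡pairSum : ∀ n α → countMinors n (ℤ.+ α) ≡ pairSum n (λ d → pairSum n (productIs α d))
countMinors≡pairSum n α = begin
  countMinors n (ℤ.+ α)
    ≡⟨ length-filter (λ q → minor n q ℤ.≟ ℤ.+ α) (quads n) ⟩
  sumOver isα (quads n)
    ≡⟨ sumOver-concatMap isα (λ r → map (r ,_) (pairs n)) (pairs n) ⟩
  sumOver (λ r → sumOver isα (map (r ,_) (pairs n))) (pairs n)
    ≡⟨ sumOver-cong (pairs n) (All.map rowPair (pairs-increasing n)) ⟩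
  pairSum n (λ d → pairSum n (productIs α d)) ∎
  where
  open ≡-Reasoning
  isα : Quad n → ℕ
  isα q = 𝟙 (minor n q ℤ.≟ ℤ.+ α)
  rowPair : ∀ {r} → toℕ (proj₁ r) < toℕ (proj₂ r) →
            sumOver isα (map (r ,_) (pairs n)) ≡ pairSum n (productIs α (gap r))
  rowPair {i , i'} i<i' = trans (sumOver-map isα (_ ,_) (pairs n))
    (sumOver-cong (pairs n) (All.map (λ {c} → columnPair c) (pairs-increasing n)))
    where
    columnPair : ∀ c → toℕ (proj₁ c) < toℕ (proj₂ c) →
                 isα ((i , i') , c) ≡ productIs α (gap (i , i')) (gap c)
    columnPair (j , j') j<j' = cong (λ z → 𝟙 (z ℤ.≟ ℤ.+ α)) (minor≡gap*gap n i i' j j' i<i' j<j')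

pairsFrom : ℕ → (ℕ → ℕ) → ℕ → ℕ
pairsFrom n g a = sumBelow (λ b → 𝟙 (a <? b) * g (b ∸ a)) n

pairSum≡sumBelow : ∀ n g → pairSum n g ≡ sumBelow (pairsFrom n g) n
pairSum≡sumBelow n g = begin
  sumOver (g ∘ gap) (filter increasing? allPairs)
    ≡⟨ sumOver-filter increasing? (g ∘ gap) allPairs ⟩
  sumOver w allPairs
    ≡⟨ sumOver-concatMap w (λ i → map (i ,_) (allFin n)) (allFin n) ⟩
  sumOver (λ i → sumOver w (map (i ,_) (allFin n))) (allFin n)
    ≡⟨ sumOver-cong (allFin n) (All.universal (λ i → sumOver-map w (i ,_) (allFin n)) (allFin n)) ⟩
  sumOver (λ i → sumOver (λ i' → w (i , i')) (allFin n)) (allFin n)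
    ≡⟨ sumOver-tabulate n _ _ (pairsFrom n g) (λ i → sumOver-tabulate n _ _ _ (λ i' → refl)) ⟩
  sumBelow (pairsFrom n g) n ∎
  where
  open ≡-Reasoning
  allPairs = concatMap (λ i → map (i ,_) (allFin n)) (allFin n)
  increasing? = λ (r : Fin n × Fin n) → toℕ (proj₁ r) <? toℕ (proj₂ r)
  w : Fin n × Fin n → ℕ
  w r = 𝟙 (increasing? r) * g (gap r)

pairsFrom-lower : ∀ n g a h → a + h < n → sumBelow (g ∘ suc) h ≤ pairsFrom n g a
pairsFrom-lower n g a h a+h<n = begin
  sumBelow (g ∘ suc) h                           ≤⟨ sumBelow-prefix (g ∘ suc) h≤rest ⟩
  sumBelow (g ∘ suc) rest                        ≡⟨ sumBelow-cong rest term ⟩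
  sumBelow (λ x → F (suc a + x)) rest            ≤⟨ m≤n+m _ _ ⟩
  sumBelow F (suc a) + sumBelow (λ x → F (suc a + x)) rest ≡⟨ sym (sumBelow-split F (suc a) rest) ⟩
  sumBelow F (suc a + rest)                      ≡⟨ cong (sumBelow F) (m+[n∸m]≡n a<n) ⟩
  sumBelow F n                                   ∎
  where
  open ≤-Reasoning
  F = λ b → 𝟙 (a <? b) * g (b ∸ a)
  rest = n ∸ suc a
  a<n : suc a ≤ n
  a<n = ≤-trans (s≤s (m≤m+n a h)) a+h<n
  h≤rest : h ≤ rest
  h≤rest = m+n≤o⇒m≤o∸n h (subst (_≤ n) (+-comm (suc a) h) a+h<n)
  term : ∀ x → g (suc x) ≡ F (suc a + x)
  term x = sym (begin-equality
    𝟙 (a <? suc a + x) * g (suc a + x ∸ a)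
      ≡⟨ cong (_* g (suc a + x ∸ a)) (𝟙-true (a <? suc a + x) (s≤s (m≤m+n a x))) ⟩
    g (suc a + x ∸ a) + 0
      ≡⟨ +-identityʳ _ ⟩
    g (suc a + x ∸ a)
      ≡⟨ cong g (trans (cong (_∸ a) (sym (+-suc a x))) (m+n∸m≡n a (suc x))) ⟩
    g (suc x) ∎)

pairSum-lower : ∀ n g h → h ≤ n → (n ∸ h) * sumBelow (g ∘ suc) h ≤ pairSum n g
pairSum-lower n g h h≤n = begin
  (n ∸ h) * sumBelow (g ∘ suc) h ≤⟨ sumBelow-lower (pairsFrom n g) _ (n ∸ h) early-starts ⟩
  sumBelow (pairsFrom n g) (n ∸ h) ≤⟨ sumBelow-prefix (pairsFrom n g) (m∸n≤m n h) ⟩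
  sumBelow (pairsFrom n g) n     ≡⟨ sym (pairSum≡sumBelow n g) ⟩
  pairSum n g                    ∎
  where
  open ≤-Reasoning
  early-starts : ∀ a → a < n ∸ h → sumBelow (g ∘ suc) h ≤ pairsFrom n g a
  early-starts a a<n∸h = pairsFrom-lower n g a h (subst (_ <_) (m∸n+n≡m h≤n) (+-monoˡ-< h a<n∸h))

-- If D lists distinct divisors of α, where 1 ≤ α ≤ h ≤ n, then at least (n − h)² · |D|
-- minors of A equal α: for each d ∈ D take rows at gap d and columns at gap α / d,
-- both gaps lying in [1, h].
countMinors-lower : ∀ n h α (D : List ℕ) → h ≤ n → 1 ≤ α → α ≤ h → Unique D → All (_∣ α) D →
                    (n ∸ h) * ((n ∸ h) * length D) ≤ countMinors n (ℤ.+ α)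
countMinors-lower n h α D h≤n 1≤α α≤h uniqueD divisorsD = begin
  m * (m * length D)                           ≤⟨ *-monoʳ-≤ m (*-monoʳ-≤ m length-D) ⟩
  m * (m * sumBelow (cofactors ∘ suc) h)       ≡⟨ cong (m *_) (sym (sumBelow-scale (cofactors ∘ suc) m h)) ⟩
  m * sumBelow (λ d → m * cofactors (suc d)) h
    ≤⟨ *-monoʳ-≤ m (sumBelow-mono h (λ d _ → pairSum-lower n (productIs α (suc d)) h h≤n)) ⟩
  m * sumBelow (λ d → pairSum n (productIs α (suc d))) h
    ≤⟨ pairSum-lower n (λ d → pairSum n (productIs α d)) h h≤n ⟩
  pairSum n (λ d → pairSum n (productIs α d)) ≡⟨ sym (countMinors≡pairSum n α) ⟩
  countMinors n (ℤ.+ α)                        ∎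
  where
  open ≤-Reasoning
  instance _ = >-nonZero 1≤α
  m = n ∸ h
  cofactors : ℕ → ℕ
  cofactors d = sumBelow (productIs α d ∘ suc) h
  cofactor-exists : ∀ {d} → d ∣ α → 1 ≤ cofactors d
  cofactor-exists (divides zero α≡0) = contradiction (subst (1 ≤_) α≡0 1≤α) λ ()
  cofactor-exists {d} (divides (suc e) α≡e*d) = begin
    1
      ≡⟨ sym (𝟙-true (ℤ.+ (d * suc e) ℤ.≟ ℤ.+ α) (cong ℤ.+_ (trans (*-comm d (suc e)) (sym α≡e*d)))) ⟩
    productIs α d (suc e)
      ≤⟨ term≤sumBelow (productIs α d ∘ suc) (≤-trans (∣⇒≤ (divides d (trans α≡e*d (*-comm (suc e) d)))) α≤h) ⟩
    cofactors d ∎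
  in-range : ∀ {d} → d ∣ α → d ∈ applyUpTo suc h
  in-range {zero}  0∣α = contradiction (subst (1 ≤_) (0∣⇒≡0 0∣α) 1≤α) λ ()
  in-range {suc d} d∣α = ∈-applyUpTo⁺ suc (≤-trans (∣⇒≤ d∣α) α≤h)
  length-D : length D ≤ sumBelow (cofactors ∘ suc) h
  length-D = begin
    length D                            ≤⟨ length≤sumOver cofactors D (All.map cofactor-exists divisorsD) ⟩
    sumOver cofactors D                 ≤⟨ sumOver-⊆ cofactors D _ uniqueD (All.map in-range divisorsD) ⟩
    sumOver cofactors (applyUpTo suc h) ≡⟨ sumOver-applyUpTo cofactors suc h ⟩
    sumBelow (cofactors ∘ suc) h        ∎

-- The products of all sublists of ps; for distinct primes these are the 2^|ps|
-- distinct divisors of the squarefree number product ps.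
subproducts : List ℕ → List ℕ
subproducts []       = 1 ∷ []
subproducts (p ∷ ps) = subproducts ps ++ map (p *_) (subproducts ps)

-- There are 2^|ps| subproducts, each dividing product ps; for distinct primes they are
-- distinct, since p ∤ product ps separates the two halves of the list.
length-subproducts : ∀ ps → length (subproducts ps) ≡ 2 ^ length ps
length-subproducts []       = refl
length-subproducts (p ∷ ps) = begin
  length (subproducts ps ++ map (p *_) (subproducts ps))
    ≡⟨ length-++ (subproducts ps) ⟩
  length (subproducts ps) + length (map (p *_) (subproducts ps))
    ≡⟨ cong (length (subproducts ps) +_) (length-map (p *_) (subproducts ps)) ⟩
  length (subproducts ps) + length (subproducts ps)
    ≡⟨ cong₂ _+_ (length-subproducts ps) (trans (length-subproducts ps) (sym (+-identityʳ _))) ⟩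
  2 ^ length ps + (2 ^ length ps + 0) ∎
  where open ≡-Reasoning

subproducts-∣ : ∀ ps → All (_∣ product ps) (subproducts ps)
subproducts-∣ []       = divides 1 refl ∷ []
subproducts-∣ (p ∷ ps) =
  AllP.++⁺ (All.map (∣n⇒∣m*n p) (subproducts-∣ ps)) (AllP.map⁺ (All.map (*-monoʳ-∣ p) (subproducts-∣ ps)))

subproducts-unique : ∀ ps → All Prime ps → Unique ps → Unique (subproducts ps)
subproducts-unique []       _            _            = [] ∷ []
subproducts-unique (p ∷ ps) (p-prime ∷ ps-prime) (p∉ps ∷ ps-unique) =
  Unique.++⁺ unique (Unique.map⁺ (*-cancelˡ-≡ _ _ p) unique) disjoint
  where
  instance _ = prime⇒nonZero p-prime
  unique = subproducts-unique ps ps-prime ps-unique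
  p∤product : ¬ (p ∣ product ps)
  p∤product p∣ = All.lookup p∉ps (factorisationHasAllPrimeFactors p-prime p∣ ps-prime) refl
  disjoint : ∀ {v} → ¬ (v ∈ subproducts ps × v ∈ map (p *_) (subproducts ps))
  disjoint (v∈ , v∈p*) with d , _ , refl ← ∈-map⁻ (p *_) v∈p* =
    p∤product (∣-trans (m∣m*n d) (All.lookup (subproducts-∣ ps) v∈))

rising : ℕ → ℕ → ℕ
rising a zero    = a
rising a (suc k) = rising a k * (a + suc k)

rising-shift : ∀ a k → rising a (suc k) ≡ a * rising (suc a) k
rising-shift a zero    = cong (a *_) (+-comm a 1)
rising-shift a (suc k) = begin
  rising a (suc k) * (a + suc (suc k))     ≡⟨ cong₂ _*_ (rising-shift a k) (+-suc a (suc k)) ⟩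
  a * rising (suc a) k * (suc a + suc k)   ≡⟨ *-assoc a _ _ ⟩
  a * (rising (suc a) k * (suc a + suc k)) ∎
  where open ≡-Reasoning

-- By induction
-- on k: the rising product of length k+2 divides both M k! (a+k+1) and M k! a, hence
-- their difference M k! (k+1) = M (k+1)!.
rising-∣ : ∀ k a M → (∀ i → i ≤ k → a + i ∣ M) → rising a k ∣ M * k !
rising-∣ zero    a M all∣ = subst₂ _∣_ (+-identityʳ a) (sym (*-identityʳ M)) (all∣ 0 z≤n)
rising-∣ (suc k) a M all∣ = subst (rising a (suc k) ∣_) (shape M (k !) k) (∣m+n∣m⇒∣n ∣F*[a+k+1] ∣F*a)
  where
  F = M * k !
  ∣F*[a+k+1] : rising a (suc k) ∣ F * a + F * suc k
  ∣F*[a+k+1] = subst (rising a (suc k) ∣_) (*-distribˡ-+ F a (suc k))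
    (*-monoˡ-∣ (a + suc k) (rising-∣ k a M (λ i i≤k → all∣ i (m≤n⇒m≤1+n i≤k))))
  ∣F*a : rising a (suc k) ∣ F * a
  ∣F*a = subst₂ _∣_ (sym (rising-shift a k)) (*-comm a F)
    (*-monoʳ-∣ a (rising-∣ k (suc a) M (λ i i≤k → subst (_∣ M) (+-suc a i) (all∣ (suc i) (s≤s i≤k)))))
  shape : ∀ M f k → M * f * suc k ≡ M * (suc k * f)
  shape = solve-∀

-- (a+1)(a+2) ⋯ (a+1+k) ≥ 2^k k! when k ≤ a, the factor a+1+i being at least 2i.
rising-lower : ∀ a k → k ≤ a → 2 ^ k * k ! ≤ rising (suc a) k
rising-lower a zero    _   = s≤s z≤n
rising-lower a (suc k) k<a = begin
  2 ^ suc k * suc k !                     ≡⟨ shape (2 ^ k) (k !) k ⟩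
  (2 ^ k * k !) * (suc k + suc k)
    ≤⟨ *-mono-≤ (rising-lower a k (<⇒≤ k<a)) (+-monoˡ-≤ (suc k) (m≤n⇒m≤1+n k<a)) ⟩
  rising (suc a) k * (suc a + suc k)      ∎
  where
  open ≤-Reasoning
  shape : ∀ t f k → 2 * t * (suc k * f) ≡ t * f * (suc k + suc k)
  shape = solve-∀

lcm-lower : ∀ k M → 0 < M → (∀ i → i ≤ k → suc k + i ∣ M) → 2 ^ k ≤ M
lcm-lower k M 0<M all∣ = *-cancelʳ-≤ (2 ^ k) M (k !) (begin
  2 ^ k * k !      ≤⟨ rising-lower k k ≤-refl ⟩
  rising (suc k) k ≤⟨ ∣⇒≤ (rising-∣ k (suc k) M all∣) ⟩
  M * k !          ∎)
  where
  open ≤-Reasoning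
  instance
    _ = k !≢0
    _ = m*n≢0 M (k !) {{>-nonZero 0<M}}

prime≥2 : ∀ {p} → Prime p → 2 ≤ p
prime≥2 {p} p-prime = nonTrivial⇒n>1 p {{prime⇒nonTrivial p-prime}}

^-cancelʳ-< : ∀ p a b → 2 ≤ p → p ^ a < p ^ b → a < b
^-cancelʳ-< p a b 2≤p p^a<p^b with a <? b
... | yes a<b = a<b
... | no  a≮b = contradiction p^a<p^b (≤⇒≯ (^-monoʳ-≤ p {{>-nonZero (≤-trans (s≤s z≤n) 2≤p)}} (≮⇒≥ a≮b)))

^-cancelʳ-≤ : ∀ p a b → 2 ≤ p → p ^ a ≤ p ^ b → a ≤ b
^-cancelʳ-≤ p a b 2≤p p^a≤p^b with a ≤? b
... | yes a≤b = a≤b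
... | no  a≰b = contradiction p^a≤p^b (<⇒≱ (^-monoʳ-< p 2≤p (≰⇒> a≰b)))

split-power : ∀ {p} → Prime p → ∀ j → 1 ≤ j → Acc _<_ j →
              Σ ℕ λ c → Σ ℕ λ j' → j ≡ p ^ c * j' × ¬ (p ∣ j')
split-power {p} p-prime j 1≤j (acc smaller) with p ∣? j
... | no  p∤j = 0 , j , sym (+-identityʳ j) , p∤j
... | yes (divides q j≡q*p) = extend (split-power p-prime q 1≤q (smaller q<j))
  where
  1≤q : 1 ≤ q
  1≤q = n≢0⇒n>0 λ q≡0 → contradiction (subst (1 ≤_) (trans j≡q*p (cong (_* p) q≡0)) 1≤j) λ ()
  q<j : q < j
  q<j = subst (q <_) (sym j≡q*p) (m<m*n q p {{>-nonZero 1≤q}} (prime≥2 p-prime))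
  shape : ∀ x y p → x * y * p ≡ p * x * y
  shape = solve-∀
  extend : (Σ ℕ λ c → Σ ℕ λ j' → q ≡ p ^ c * j' × ¬ (p ∣ j')) →
           Σ ℕ λ c → Σ ℕ λ j' → j ≡ p ^ c * j' × ¬ (p ∣ j')
  extend (c , j' , q≡ , p∤j') = suc c , j' , trans j≡q*p (trans (cong (_* p) q≡) (shape (p ^ c) j' p)) , p∤j'

prime-factor : ∀ j → 2 ≤ j → Σ ℕ λ p → Prime p × p ∣ j
prime-factor j@(suc _) 2≤j with factorise j
... | record { factors = [] ; isFactorisation = j≡1 } = contradiction (subst (2 ≤_) j≡1 2≤j) λ { (s≤s ()) }
... | record { factors = p ∷ ps ; isFactorisation = j≡p*ps ; factorsPrime = p-prime ∷ _ } =
  p , p-prime , divides (product ps) (trans j≡p*ps (*-comm p (product ps)))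

powerProduct : List ℕ → ℕ → ℕ
powerProduct ps t = product (map (_^ t) ps)

-- A number j < 2^(t+1) whose prime factors all lie in ps divides Π_{p ∈ ps} p^t:
-- the exact power p^c dividing j satisfies p^c ≤ j < 2^(t+1) ≤ p^(t+1), so c ≤ t.
smooth-∣ : ∀ ps t j → All Prime ps → 1 ≤ j → j < 2 ^ suc t →
           (∀ q → Prime q → q ∣ j → q ∈ ps) → j ∣ powerProduct ps t
smooth-∣ []       t (suc zero)          _ _ _ _          = ∣-refl
smooth-∣ []       t j@(suc (suc _))     _ _ _ factors∈[]
  with q , q-prime , q∣j ← prime-factor j (s≤s (s≤s z≤n))
  with () ← factors∈[] q q-prime q∣j
smooth-∣ (p ∷ ps) t j (p-prime ∷ ps-prime) 1≤j j<2^t+1 factors∈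
  with c , j' , j≡ , p∤j' ← split-power p-prime j 1≤j (<-wellFounded j) =
  subst (_∣ powerProduct (p ∷ ps) t) (sym j≡) (*-pres-∣ p^c∣p^t j'∣rest)
  where
  instance _ = prime⇒nonZero p-prime
  1≤j' : 1 ≤ j'
  1≤j' = n≢0⇒n>0 λ j'≡0 → p∤j' (subst (p ∣_) (sym j'≡0) (p ∣0))
  p^c≤j : p ^ c ≤ j
  p^c≤j = subst (p ^ c ≤_) (sym j≡) (m≤m*n (p ^ c) j' {{>-nonZero 1≤j'}})
  j'≤j : j' ≤ j
  j'≤j = subst (j' ≤_) (sym j≡) (m≤n*m j' (p ^ c) {{m^n≢0 p c}})
  c≤t : c ≤ t
  c≤t = ≤-pred (^-cancelʳ-< p c (suc t) (prime≥2 p-prime)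
          (≤-<-trans p^c≤j (<-≤-trans j<2^t+1 (^-monoˡ-≤ (suc t) (prime≥2 p-prime)))))
  p^c∣p^t : p ^ c ∣ p ^ t
  p^c∣p^t = divides (p ^ (t ∸ c)) (trans (cong (p ^_) (sym (m∸n+n≡m c≤t))) (^-distribˡ-+-* p (t ∸ c) c))
  j'∣rest : j' ∣ powerProduct ps t
  j'∣rest = smooth-∣ ps t j' ps-prime 1≤j' (≤-<-trans j'≤j j<2^t+1) factors∈ps
    where
    factors∈ps : ∀ q → Prime q → q ∣ j' → q ∈ ps
    factors∈ps q q-prime q∣j' with factors∈ q q-prime (subst (q ∣_) (sym j≡) (∣n⇒∣m*n (p ^ c) q∣j'))
    ... | here refl = contradiction q∣j' p∤j'
    ... | there q∈ps = q∈ps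

primesUpTo : ℕ → List ℕ
primesUpTo m = filter prime? (upTo (suc m))

primesUpTo-prime : ∀ m → All Prime (primesUpTo m)
primesUpTo-prime m = AllP.all-filter prime? (upTo (suc m))

primesUpTo-≤ : ∀ m → All (_≤ m) (primesUpTo m)
primesUpTo-≤ m = AllP.filter⁺ prime? (All.tabulate (≤-pred ∘ ∈-upTo⁻))

primesUpTo-complete : ∀ {m q} → Prime q → q ≤ m → q ∈ primesUpTo m
primesUpTo-complete q-prime q≤m = ∈-filter⁺ prime? (∈-upTo⁺ (s≤s q≤m)) q-prime

primesUpTo-unique : ∀ m → Unique (primesUpTo m)
primesUpTo-unique m = Unique.filter⁺ prime? (Unique.upTo⁺ (suc m))

product-≤ : ∀ ns m → All (_≤ m) ns → product ns ≤ m ^ length ns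
product-≤ []       m []           = ≤-refl
product-≤ (n ∷ ns) m (n≤m ∷ ns≤m) = *-mono-≤ n≤m (product-≤ ns m ns≤m)

powerProduct-≤ : ∀ ps t m → All (_≤ m) ps → powerProduct ps t ≤ m ^ (t * length ps)
powerProduct-≤ ps t m ps≤m = begin
  product (map (_^ t) ps)               ≤⟨ product-≤ (map (_^ t) ps) (m ^ t) (AllP.map⁺ (All.map (^-monoˡ-≤ t) ps≤m)) ⟩
  (m ^ t) ^ length (map (_^ t) ps)      ≡⟨ cong ((m ^ t) ^_) (length-map (_^ t) ps) ⟩
  (m ^ t) ^ length ps                   ≡⟨ ^-*-assoc m t (length ps) ⟩
  m ^ (t * length ps)                   ∎
  where open ≤-Reasoning

-- Chebyshev-type lower bound for the number π of primes up to m = 2k+1 < 2^(t+1):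
-- k+1, …, 2k+1 all divide M = Π_{p ≤ m} p^t, so 2^k ≤ M ≤ m^(t π) ≤ 2^((t+1) t π).
primeCount-lower : ∀ k t → 2 * k + 1 < 2 ^ suc t → k ≤ suc t * (t * length (primesUpTo (2 * k + 1)))
primeCount-lower k t m<2^t+1 = ^-cancelʳ-≤ 2 k _ (s≤s (s≤s z≤n)) (begin
  2 ^ k                 ≤⟨ lcm-lower k M 0<M window∣M ⟩
  M                     ≤⟨ powerProduct-≤ ps t m (primesUpTo-≤ m) ⟩
  m ^ (t * π)           ≤⟨ ^-monoˡ-≤ (t * π) (<⇒≤ m<2^t+1) ⟩
  (2 ^ suc t) ^ (t * π) ≡⟨ ^-*-assoc 2 (suc t) (t * π) ⟩
  2 ^ (suc t * (t * π)) ∎)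
  where
  open ≤-Reasoning
  m  = 2 * k + 1
  ps = primesUpTo m
  π  = length ps
  M  = powerProduct ps t
  0<M : 0 < M
  0<M = >-nonZero⁻¹ M {{product≢0 (AllP.map⁺ (All.map p^t≢0 (primesUpTo-prime m)))}}
    where
    p^t≢0 : ∀ {p} → Prime p → NonZero (p ^ t)
    p^t≢0 p-prime = m^n≢0 _ t {{prime⇒nonZero p-prime}}
  window∣M : ∀ i → i ≤ k → suc k + i ∣ M
  window∣M i i≤k =
    smooth-∣ ps t (suc k + i) (primesUpTo-prime m) (s≤s z≤n) (≤-<-trans k+1+i≤m m<2^t+1) factors∈
    where
    k+1+i≤m : suc k + i ≤ m
    k+1+i≤m = ≤-trans (+-monoʳ-≤ (suc k) i≤k) (≤-reflexive (shape k))
      where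
      shape : ∀ k → suc k + k ≡ 2 * k + 1
      shape = solve-∀
    factors∈ : ∀ q → Prime q → q ∣ suc k + i → q ∈ ps
    factors∈ q q-prime q∣ = primesUpTo-complete q-prime (≤-trans (∣⇒≤ q∣) k+1+i≤m)

double-half≤ : ∀ n → 2 * ⌊ n /2⌋ ≤ n
double-half≤ n = begin
  2 * ⌊ n /2⌋             ≡⟨ cong (⌊ n /2⌋ +_) (+-identityʳ ⌊ n /2⌋) ⟩
  ⌊ n /2⌋ + ⌊ n /2⌋       ≤⟨ +-monoʳ-≤ ⌊ n /2⌋ (⌊n/2⌋≤⌈n/2⌉ n) ⟩
  ⌊ n /2⌋ + ⌈ n /2⌉       ≡⟨ ⌊n/2⌋+⌈n/2⌉≡n n ⟩
  n                       ∎
  where open ≤-Reasoning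

2^log₂≤ : ∀ n → 1 ≤ n → 2 ^ ⌊log₂ n ⌋ ≤ n
2^log₂≤ n = byLogValue ⌊log₂ n ⌋ n refl
  where
  byLogValue : ∀ k n → ⌊log₂ n ⌋ ≡ k → 1 ≤ n → 2 ^ k ≤ n
  byLogValue zero    n               _    1≤n = 1≤n
  byLogValue (suc k) n@(suc (suc _)) log≡ _   = begin
    2 * 2 ^ k       ≤⟨ *-monoʳ-≤ 2 (byLogValue k ⌊ n /2⌋ log-half≡k (s≤s z≤n)) ⟩
    2 * ⌊ n /2⌋     ≤⟨ double-half≤ n ⟩
    n               ∎
    where
    open ≤-Reasoning
    log-half≡k : ⌊log₂ ⌊ n /2⌋ ⌋ ≡ k
    log-half≡k = trans (⌊log₂⌊n/2⌋⌋≡⌊log₂n⌋∸1 n) (cong (_∸ 1) log≡)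

<2^suc[log₂] : ∀ n → n < 2 ^ suc ⌊log₂ n ⌋
<2^suc[log₂] n with n <? 2 ^ suc ⌊log₂ n ⌋
... | yes n< = n<
... | no  n≮ = contradiction (⌊log₂⌋-mono-≤ (≮⇒≥ n≮))
                 (<⇒≱ (subst (⌊log₂ n ⌋ <_) (sym (⌊log₂[2^n]⌋≡n _)) ≤-refl))

suc≤2^ : ∀ n → suc n ≤ 2 ^ n
suc≤2^ zero    = s≤s z≤n
suc≤2^ (suc n) = begin
  1 + suc n         ≤⟨ +-mono-≤ (≤-trans (s≤s z≤n) (suc≤2^ n)) (suc≤2^ n) ⟩
  2 ^ n + 2 ^ n     ≡⟨ cong (2 ^ n +_) (sym (+-identityʳ _)) ⟩
  2 ^ suc n         ∎
  where open ≤-Reasoning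

linear≤2^ : ∀ L → 8 ≤ L → 16 * L + 33 ≤ 2 ^ L
linear≤2^ L 8≤L = subst (λ L → 16 * L + 33 ≤ 2 ^ L) (m+[n∸m]≡n 8≤L) (from8 (L ∸ 8))
  where
  from8 : ∀ a → 16 * (8 + a) + 33 ≤ 2 ^ (8 + a)
  from8 zero    = m≤m+n 161 95
  from8 (suc a) = begin
    16 * (9 + a) + 33          ≡⟨ shape a ⟩
    16 + (16 * (8 + a) + 33)   ≤⟨ +-mono-≤ (^-monoʳ-≤ 2 {4} {8 + a} (m≤m+n 4 (4 + a))) (from8 a) ⟩
    2 ^ (8 + a) + 2 ^ (8 + a)  ≡⟨ cong (2 ^ (8 + a) +_) (sym (+-identityʳ _)) ⟩
    2 ^ (9 + a)                ∎
    where
    open ≤-Reasoning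
    shape : ∀ a → 16 * (9 + a) + 33 ≡ 16 + (16 * (8 + a) + 33)
    shape = solve-∀

-- (4 + 2L)(s + 1) + 32 L + 1 ≤ 8 L s once L, s ≥ 8: writing L = 8 + b and s = 8 + a,
-- the difference is the polynomial 6ab + 44a + 14b + 75 with nonnegative coefficients.
polynomial-slack : ∀ L s → 8 ≤ L → 8 ≤ s → 4 + 2 * L + s * (4 + 2 * L) + (32 * L + 1) ≤ 8 * L * s
polynomial-slack L s 8≤L 8≤s =
  subst₂ (λ L s → 4 + 2 * L + s * (4 + 2 * L) + (32 * L + 1) ≤ 8 * L * s) (m+[n∸m]≡n 8≤L) (m+[n∸m]≡n 8≤s)
    (shifted (L ∸ 8) (s ∸ 8))
  where
  shifted : ∀ b a → 4 + 2 * (8 + b) + (8 + a) * (4 + 2 * (8 + b)) + (32 * (8 + b) + 1) ≤ 8 * (8 + b) * (8 + a)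
  shifted b a = subst (4 + 2 * (8 + b) + (8 + a) * (4 + 2 * (8 + b)) + (32 * (8 + b) + 1) ≤_) (identity a b)
                  (m≤m+n _ (6 * (a * b) + 44 * a + 14 * b + 75))
    where
    identity : ∀ a b → 4 + 2 * (8 + b) + (8 + a) * (4 + 2 * (8 + b)) + (32 * (8 + b) + 1)
                         + (6 * (a * b) + 44 * a + 14 * b + 75) ≡ 8 * (8 + b) * (8 + a)
    identity = solve-∀

-- The exponent bookkeeping of the main theorem: with s = ⌊v / (2L+4)⌋,
-- (v + 2)(16 L + 1) ≤ 8 L (v + (v + s)) once L ≥ 8 and 2^L ≤ v + 1.
exponent-bound : ∀ L v → 8 ≤ L → 2 ^ L ≤ suc v →
                 (2 + v) * (2 * 8 * L + 1) ≤ 8 * L * (v + (v + v / (4 + 2 * L)))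
exponent-bound L v 8≤L 2^L≤v+1 = begin
  (2 + v) * (2 * 8 * L + 1)          ≡⟨ expand v L ⟩
  8 * L * (v + v) + (suc v + (32 * L + 1)) ≤⟨ +-monoʳ-≤ (8 * L * (v + v)) small ⟩
  8 * L * (v + v) + 8 * L * s        ≡⟨ sym (*-distribˡ-+ (8 * L) (v + v) s) ⟩
  8 * L * (v + v + s)                ≡⟨ cong (8 * L *_) (+-assoc v v s) ⟩
  8 * L * (v + (v + s))              ∎
  where
  open ≤-Reasoning
  B = 4 + 2 * L
  s = v / B
  v<[s+1]B : suc v ≤ B + s * B
  v<[s+1]B = begin
    suc v               ≡⟨ cong suc (m≡m%n+[m/n]*n v B) ⟩
    suc (v % B + s * B) ≤⟨ +-monoˡ-≤ (s * B) (m%n<n v B) ⟩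
    B + s * B           ∎
  16L+33≤2^L : 16 * L + 32 + 1 ≤ 2 ^ L
  16L+33≤2^L = subst (_≤ 2 ^ L) (sym (+-assoc (16 * L) 32 1)) (linear≤2^ L 8≤L)
  8≤s : 8 ≤ s
  8≤s = subst (_≤ s) (m*n/n≡m 8 B) (/-monoˡ-≤ B (begin
    8 * B            ≡⟨ *-distribˡ-+ 8 4 (2 * L) ⟩
    32 + 8 * (2 * L) ≡⟨ +-comm 32 _ ⟩
    8 * (2 * L) + 32 ≡⟨ cong (_+ 32) (sym (*-assoc 8 2 L)) ⟩
    16 * L + 32      ≤⟨ m+n≤o⇒m≤o∸n (16 * L + 32) 16L+33≤2^L ⟩
    2 ^ L ∸ 1        ≤⟨ ∸-monoˡ-≤ 1 2^L≤v+1 ⟩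
    v                ∎))
  small : suc v + (32 * L + 1) ≤ 8 * L * s
  small = begin
    suc v + (32 * L + 1)     ≤⟨ +-monoˡ-≤ (32 * L + 1) v<[s+1]B ⟩
    B + s * B + (32 * L + 1) ≤⟨ polynomial-slack L s 8≤L 8≤s ⟩
    8 * L * s                ∎
  expand : ∀ v L → (2 + v) * (2 * 8 * L + 1) ≡ 8 * L * (v + v) + (suc v + (32 * L + 1))
  expand = solve-∀

-- Take the first s primes up to m = 2^(2L+4) − 1: Chebyshev's bound
-- with k = 2^(2L+3) − 1 guarantees at least s of them, and their product is at most
-- m^s ≤ 2^((2L+4) s) ≤ 2^v.
small-primes : ∀ L v → v < 2 ^ suc L →
  Σ (List ℕ) λ ps → All Prime ps × Unique ps × length ps ≡ v / (4 + 2 * L) × product ps ≤ 2 ^ v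
small-primes L v v<2^L+1 =
  ps , AllP.take⁺ s (primesUpTo-prime m) , Unique.take⁺ s (primesUpTo-unique m) ,
  trans (length-take s (primesUpTo m)) (m≤n⇒m⊓n≡m s≤π) , product-bound
  where
  open ≤-Reasoning
  T = 3 + 2 * L
  B = suc T
  s = v / B
  k = pred (2 ^ T)
  m = 2 * k + 1
  π = length (primesUpTo m)
  ps = take s (primesUpTo m)
  m<2^B : m < 2 ^ B
  m<2^B = subst (m <_) (cong (2 *_) (suc-pred (2 ^ T) {{m^n≢0 2 T}})) (≤-reflexive (sym (shape k)))
    where
    shape : ∀ k → 2 * suc k ≡ suc (2 * k + 1)
    shape = solve-∀
  T≤2^[2+L] : T ≤ 2 ^ (2 + L)
  T≤2^[2+L] = begin
    3 + 2 * L          ≤⟨ m≤m+n (3 + 2 * L) (1 + 2 * L) ⟩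
    3 + 2 * L + (1 + 2 * L) ≡⟨ shape L ⟩
    4 * suc L          ≤⟨ *-monoʳ-≤ 4 (suc≤2^ L) ⟩
    4 * 2 ^ L          ≡⟨ *-assoc 2 2 (2 ^ L) ⟩
    2 ^ (2 + L)        ∎
    where
    shape : ∀ L → 3 + 2 * L + (1 + 2 * L) ≡ 4 * suc L
    shape = solve-∀
  -- s (2L+4)(2L+3) ≤ v (2L+3) < 2^(L+2) 2^(L+1) = 2^(2L+3), which is at most k + 1
  s≤π : s ≤ π
  s≤π = *-cancelˡ-≤ T (*-cancelˡ-≤ B (begin
    B * (T * s)               ≡⟨ shape B T s ⟩
    T * (s * B)               ≤⟨ *-monoʳ-≤ T (m/n*n≤m v B) ⟩
    T * v                     ≤⟨ <⇒≤pred (begin-strict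
      T * v                     <⟨ *-monoʳ-< T v<2^L+1 ⟩
      T * 2 ^ suc L             ≤⟨ *-monoˡ-≤ (2 ^ suc L) T≤2^[2+L] ⟩
      2 ^ (2 + L) * 2 ^ suc L   ≡⟨ sym (^-distribˡ-+-* 2 (2 + L) (suc L)) ⟩
      2 ^ (2 + L + suc L)       ≡⟨ cong (2 ^_) (shape′ L) ⟩
      2 ^ T                     ∎) ⟩
    k                         ≤⟨ primeCount-lower k T m<2^B ⟩
    B * (T * π)               ∎))
    where
    shape : ∀ B T s → B * (T * s) ≡ T * (s * B)
    shape = solve-∀
    shape′ : ∀ L → 2 + L + suc L ≡ 3 + 2 * L
    shape′ = solve-∀
  product-bound : product ps ≤ 2 ^ v
  product-bound = begin
    product ps        ≤⟨ product-≤ ps m (AllP.take⁺ s (primesUpTo-≤ m)) ⟩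
    m ^ length ps     ≡⟨ cong (m ^_) (trans (length-take s (primesUpTo m)) (m≤n⇒m⊓n≡m s≤π)) ⟩
    m ^ s             ≤⟨ ^-monoˡ-≤ s (<⇒≤ m<2^B) ⟩
    (2 ^ B) ^ s       ≡⟨ ^-*-assoc 2 B s ⟩
    2 ^ (B * s)       ≤⟨ ^-monoʳ-≤ 2 (≤-trans (≤-reflexive (*-comm B s)) (m/n*n≤m v B)) ⟩
    2 ^ v             ∎

-- If 2^(v+1) ≤ n and ps are distinct primes with product α ≤ 2^v, then at least
-- 2^(v + (v + |ps|)) minors of A equal α: apply the counting bound with h = 2^v to
-- the 2^|ps| divisors of α, noting n − h ≥ h.
many-equal-minors : ∀ n v ps → 2 ^ suc v ≤ n → All Prime ps → Unique ps → product ps ≤ 2 ^ v →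
                    2 ^ (v + (v + length ps)) ≤ countMinors n (ℤ.+ product ps)
many-equal-minors n v ps 2^v+1≤n ps-prime ps-unique α≤h = begin
  2 ^ (v + (v + length ps))              ≡⟨ trans (^-distribˡ-+-* 2 v _) (cong (h *_) (^-distribˡ-+-* 2 v _)) ⟩
  h * (h * 2 ^ length ps)                ≤⟨ *-mono-≤ h≤n∸h (*-monoˡ-≤ (2 ^ length ps) h≤n∸h) ⟩
  (n ∸ h) * ((n ∸ h) * 2 ^ length ps)    ≡⟨ cong (λ x → (n ∸ h) * ((n ∸ h) * x)) (sym (length-subproducts ps)) ⟩
  (n ∸ h) * ((n ∸ h) * length (subproducts ps))
    ≤⟨ countMinors-lower n h (product ps) (subproducts ps) h≤n (productOfPrimes≥1 ps-prime) α≤h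
         (subproducts-unique ps ps-prime ps-unique) (subproducts-∣ ps) ⟩
  countMinors n (ℤ.+ product ps)         ∎
  where
  open ≤-Reasoning
  h = 2 ^ v
  h+h≤n : h + h ≤ n
  h+h≤n = subst (_≤ n) (cong (h +_) (+-identityʳ h)) 2^v+1≤n
  h≤n : h ≤ n
  h≤n = ≤-trans (m≤m+n h h) h+h≤n
  h≤n∸h : h ≤ n ∸ h
  h≤n∸h = m+n≤o⇒m≤o∸n h h+h≤n

power-comparison : ∀ n C u w e K → n ≤ 2 ^ u → 2 ^ w ≤ C → u * e ≤ K * w → n ^ e ≤ C ^ K
power-comparison n C u w e K n≤2^u 2^w≤C ue≤Kw = begin
  n ^ e          ≤⟨ ^-monoˡ-≤ e n≤2^u ⟩
  (2 ^ u) ^ e    ≡⟨ ^-*-assoc 2 u e ⟩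
  2 ^ (u * e)    ≤⟨ ^-monoʳ-≤ 2 ue≤Kw ⟩
  2 ^ (K * w)    ≡⟨ cong (2 ^_) (*-comm K w) ⟩
  2 ^ (w * K)    ≡⟨ sym (^-*-assoc 2 w K) ⟩
  (2 ^ w) ^ K    ≤⟨ ^-monoˡ-≤ K 2^w≤C ⟩
  C ^ K          ∎
  where open ≤-Reasoning

-- The theorem for n with known logarithms: if 2^t ≤ n < 2^(t+1) and 2^L ≤ t < 2^(L+1)
-- with L ≥ 8, then writing t = v + 1, the product α of the small primes for (L, v) is
-- attained by at least 2^(2v + ⌊v / (2L+4)⌋) ≥ n^(2 + 1/(8L)) minors.
equal-minors-bound : ∀ n t L → 2 ^ t ≤ n → n < 2 ^ suc t → 8 ≤ L → 2 ^ L ≤ t → t < 2 ^ suc L →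
                     Σ ℤ λ α → n ^ (2 * 8 * L + 1) ≤ countMinors n α ^ (8 * L)
equal-minors-bound n zero    L _        _         _   2^L≤0   _         = contradiction 2^L≤0 (<⇒≱ (m^n>0 2 L))
equal-minors-bound n (suc v) L 2^t≤n n<2^t+1 8≤L 2^L≤t t<2^L+1 =
  conclude (small-primes L v (<-trans (n<1+n v) t<2^L+1))
  where
  s = v / (4 + 2 * L)
  conclude : (Σ (List ℕ) λ ps → All Prime ps × Unique ps × length ps ≡ s × product ps ≤ 2 ^ v) →
             Σ ℤ λ α → n ^ (2 * 8 * L + 1) ≤ countMinors n α ^ (8 * L)
  conclude (ps , ps-prime , ps-unique , |ps|≡s , α≤2^v) =
    ℤ.+ product ps ,
    power-comparison n C (2 + v) (v + (v + s)) (2 * 8 * L + 1) (8 * L) (<⇒≤ n<2^t+1)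
      (subst (λ s → 2 ^ (v + (v + s)) ≤ C) |ps|≡s (many-equal-minors n v ps 2^t≤n ps-prime ps-unique α≤2^v))
      (exponent-bound L v 8≤L 2^L≤t)
    where
    C = countMinors n (ℤ.+ product ps)

-- For n ≥ 2^256 the logarithms t = ⌊log₂ n⌋ and L = ⌊log₂ t⌋ satisfy the hypotheses above.
mainTheorem9 : Σ ℕ λ p → Σ ℕ λ q → (1 ≤ p) × (1 ≤ q) × (Σ ℕ λ N → (n : ℕ) → N ≤ n →
                 Σ ℤ λ α → n ^ (2 * q * loglog n + p) ≤ countMinors n α ^ (q * loglog n))
mainTheorem9 = 1 , 8 , s≤s z≤n , s≤s z≤n , 2 ^ 256 , large
  where
  large : (n : ℕ) → 2 ^ 256 ≤ n → Σ ℤ λ α → n ^ (2 * 8 * loglog n + 1) ≤ countMinors n α ^ (8 * loglog n)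
  large n 2^256≤n =
    equal-minors-bound n t L (2^log₂≤ n (≤-trans (m^n>0 2 256) 2^256≤n)) (<2^suc[log₂] n)
      8≤L (2^log₂≤ t (≤-trans (s≤s z≤n) 256≤t)) (<2^suc[log₂] t)
    where
    t = ⌊log₂ n ⌋
    L = ⌊log₂ t ⌋
    -- (the bounds are passed explicitly so that the logarithms are never unfolded)
    256≤t : 256 ≤ t
    256≤t = subst (_≤ t) (⌊log₂[2^n]⌋≡n 256) (⌊log₂⌋-mono-≤ {2 ^ 256} {n} 2^256≤n)
    8≤L : 8 ≤ L
    8≤L = subst (_≤ L) (⌊log₂[2^n]⌋≡n 8) (⌊log₂⌋-mono-≤ {256} {t} 256≤t)
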